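{- Let $\Gamma;s$ be an extended context and $t_0,t_1,t_2$ terms. If $t_0\to_{\equiv}t_1$ and $\Gamma;s\vdash t_0\to_{\leq}t_2$, then for every extended context $\Gamma';s'$ with $\Gamma;s\rightarrowtail\Gamma';s'$ there exists a term $t_3$ such that $t_2\to_{\equiv}t_3$ and $\Gamma';s'\vdash t_1\to_{\leq}t_3$.
   Context: Terms: $t ::= x \mid \top \mid (\lambda x\leq t.u) \mid (u\,v)$, with $x$ from a countably infinite set of variables and $\top$ a constant; $x$ is bound in $u$ in $\lambda x\leq t.u$; terms identified up to renaming of bound variables; $\mathrm{fv}$ = free variables, $u[x:=v]$ = capture-avoiding substitution. Extended context $\Gamma;s$: a finite sequence $\Gamma$ of annotations $x\leq t$ and a finite list (stack) $s$ of terms; $\varepsilon;[]$ empty, $\Gamma,x\leq t;s$ appends an annotation, $\Gamma;\alpha::s$ pushes $\alpha$. $\mathrm{dom}(\Gamma)$ = annotated variables; $x\leq t\in\Gamma$ means the annotation occurs in $\Gamma$. Prevalidity: least predicate with $\varepsilon;[]$ prevalid; $\Gamma,x\leq t;[]$ prevalid if $\Gamma;[]$ prevalid, $x\notin\mathrm{dom}(\Gamma)$, $\mathrm{fv}(t)\subseteq\mathrm{dom}(\Gamma)$; $\Gamma;\alpha::s$ prevalid if $\Gamma;s$ prevalid and $\mathrm{fv}(\alpha)\subseteq\mathrm{dom}(\Gamma)$. Equivalence reduction $\to_{\equiv}$: least relation with $x\to_{\equiv}x$; $\top\to_{\equiv}\top$; $\top\,u\to_{\equiv}\top$; if $u\to_{\equiv}u'$,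 $v\to_{\equiv}v'$ then $u\,v\to_{\equiv}u'\,v'$ and $(\lambda x\leq t.u)\,v\to_{\equiv}u'[x:=v']$; if $t\to_{\equiv}t'$, $u\to_{\equiv}u'$ then $\lambda x\leq t.u\to_{\equiv}\lambda x\leq t'.u'$. Subtyping reduction $\Gamma;s\vdash u\to_{\leq}v$: least relation with (Prom) $\Gamma;s$ prevalid and $x\leq t\in\Gamma$ give $\Gamma;s\vdash x\to_{\leq}t$; (Top) $\Gamma;s$ prevalid gives $\Gamma;s\vdash u\to_{\leq}\top$; (Eq) $\Gamma;s$ prevalid and $u\to_{\equiv}v$ give $\Gamma;s\vdash u\to_{\leq}v$; (App) $\Gamma;v::s\vdash u\to_{\leq}u'$ gives $\Gamma;s\vdash u\,v\to_{\leq}u'\,v$; (FunOp) $\Gamma,x\leq\alpha;s\vdash u\to_{\leq}u'$ gives $\Gamma;\alpha::s\vdash\lambda x\leq t.u\to_{\leq}\lambda x\leq t.u'$; (Fun) $\Gamma,x\leq t;[]\vdash u\to_{\leq}u'$ gives $\Gamma;[]\vdash\lambda x\leq t.u\to_{\leq}\lambda x\leq t.u'$. Reduction of extended contexts $\Gamma;s\rightarrowtail\Gamma';s'$ is the least relation with: $\Gamma;s\rightarrowtail\Gamma;s$; if $\Gamma;s\rightarrowtail\Gamma';s'$ and $t\to_{\equiv}t'$ then $\Gamma,x\leq t;s\rightarrowtail\Gamma',x\leq t';s'$; if $\Gamma;s\rightarrowtail\Gamma';s'$ and $\alpha\to_{\equiv}\alpha'$ then $\Gamma;\alpha::s\rightarrowtail\Gamma';\alpha'::s'$.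 -}

module Defs where

-- Terms are represented with de Bruijn indices (so α-equivalent terms
-- are literally equal).  Variable index i refers to the i-th most recent
-- binder / context annotation.  Indices beyond the context are free
-- variables not in dom(Γ).

open import Data.Nat using (ℕ; zero; suc; _+_; _<_; compare; less; equal; greater)
open import Data.Nat.Properties using (_<?_)
open import Data.List using (List; []; _∷_; length; map)
open import Relation.Nullary using (yes; no)

data Term : Set where
  var : ℕ → Term
  top : Term
  lam : Term → Term → Term   -- lam t u  ≈  λ x ≤ t . u   (x is index 0 in u)
  app : Term → Term → Term

shiftFrom : ℕ → Term → Term
shiftFrom c (var i) with i <? c
... | yes _ = var i
... | no  _ = var (suc i)
shiftFrom c top = top
shiftFrom c (lam t u) = lam (shiftFrom c t) (shiftFrom (suc c) u)
shiftFrom c (app u v) = app (shiftFrom c u) (shiftFrom c v)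

shift : Term → Term
shift = shiftFrom 0

weaken : ℕ → Term → Term
weaken zero v = v
weaken (suc n) v = shift (weaken n v)

substAt : ℕ → Term → Term → Term
substAt j v (var i) with compare i j
... | less _ _    = var i
... | equal _     = weaken j v
... | greater _ k = var (j + k)
substAt j v top = top
substAt j v (lam t u) = lam (substAt j v t) (substAt (suc j) v u)
substAt j v (app u w) = app (substAt j v u) (substAt j v w)

_[0:=_] : Term → Term → Term
u [0:= v ] = substAt 0 v u

-- fv(t) ⊆ dom(Γ) with |Γ| = n
data Scoped : ℕ → Term → Set where
  var : ∀ {n i} → i < n → Scoped n (var i)
  top : ∀ {n} → Scoped n top
  lam : ∀ {n t u} → Scoped n t → Scoped (suc n) u → Scoped n (lam t u)
  app : ∀ {n u v} → Scoped n u → Scoped n v → Scoped n (app u v)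

-- Contexts: head of the list = most recent annotation.
-- The annotation at position i is scoped in the suffix after it.
Ctx : Set
Ctx = List Term

Stack : Set
Stack = List Term   -- head = top of the stack

-- x ≤ t ∈ Γ  (t weakened into the whole context Γ)
data _∋_≤_ : Ctx → ℕ → Term → Set where
  here  : ∀ {Γ t} → (t ∷ Γ) ∋ zero ≤ shift t
  there : ∀ {Γ u i t} → Γ ∋ i ≤ t → (u ∷ Γ) ∋ suc i ≤ shift t

data Prevalid : Ctx → Stack → Set where
  empty : Prevalid [] []
  ext   : ∀ {Γ t} → Prevalid Γ [] → Scoped (length Γ) t → Prevalid (t ∷ Γ) []
  push  : ∀ {Γ s α} → Prevalid Γ s → Scoped (length Γ) α → Prevalid Γ (α ∷ s)

infix 4 _→≡_
data _→≡_ : Term → Term → Set where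
  var   : ∀ {x} → var x →≡ var x
  top   : top →≡ top
  topApp : ∀ {u} → app top u →≡ top
  app   : ∀ {u u' v v'} → u →≡ u' → v →≡ v' → app u v →≡ app u' v'
  beta  : ∀ {t u u' v v'} → u →≡ u' → v →≡ v' → app (lam t u) v →≡ (u' [0:= v' ])
  lam   : ∀ {t t' u u'} → t →≡ t' → u →≡ u' → lam t u →≡ lam t' u'

data _⨾_⊢_→≤_ : Ctx → Stack → Term → Term → Set where
  Prom  : ∀ {Γ s x t} → Prevalid Γ s → Γ ∋ x ≤ t → Γ ⨾ s ⊢ var x →≤ t
  Top   : ∀ {Γ s u} → Prevalid Γ s → Γ ⨾ s ⊢ u →≤ top
  Eq    : ∀ {Γ s u v} → Prevalid Γ s → u →≡ v → Γ ⨾ s ⊢ u →≤ v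
  App   : ∀ {Γ s u u' v} → Γ ⨾ (v ∷ s) ⊢ u →≤ u' → Γ ⨾ s ⊢ app u v →≤ app u' v
  -- the bound variable x is fresh, so the stack is weakened into Γ , x ≤ α
  FunOp : ∀ {Γ s α t u u'} → (α ∷ Γ) ⨾ map shift s ⊢ u →≤ u' →
          Γ ⨾ (α ∷ s) ⊢ lam t u →≤ lam t u'
  Fun   : ∀ {Γ t u u'} → (t ∷ Γ) ⨾ [] ⊢ u →≤ u' → Γ ⨾ [] ⊢ lam t u →≤ lam t u'

data _⨾_↣_⨾_ : Ctx → Stack → Ctx → Stack → Set where
  refl : ∀ {Γ s} → Γ ⨾ s ↣ Γ ⨾ s
  ext  : ∀ {Γ s Γ' s' t t'} → Γ ⨾ s ↣ Γ' ⨾ s' → t →≡ t' → (t ∷ Γ) ⨾ s ↣ (t' ∷ Γ') ⨾ s'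
  push : ∀ {Γ s Γ' s' α α'} → Γ ⨾ s ↣ Γ' ⨾ s' → α →≡ α' → Γ ⨾ (α ∷ s) ↣ Γ' ⨾ (α' ∷ s')

-- Every →≡ reduct of t₀
-- reduces further to the complete development of t₀ (the triangle property), which
-- closes all cases in which the →≤ step is itself an equivalence step. The one real
-- interaction is a β-redex (λ x ≤ t. u) v whose body was reduced under FunOp: that
-- derivation lives in the context extended by x ≤ v, and substituting the reduct v′
-- for x throughout it (promotion of x itself becomes a reflexive step) yields the
-- step from the contractum. Context reduction only reduces annotations and stack
-- entries, so it preserves prevalidity and Prom steps can follow it.

module Submission where

open import Defs
open import Data.Product using (Σ; _×_; _,_)
open import Data.Nat using (ℕ; zero; suc; _+_; _<_; _≤_; z≤n; s≤s)
import Data.Nat as Nat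
open import Data.Nat.Properties
open import Data.List using ([]; _∷_; length; map; _++_)
open import Data.List.Properties using (length-++; map-∘; map-cong; map-id)
open import Data.Sum using (inj₁; inj₂)
open import Data.Empty using (⊥-elim)
open import Relation.Nullary using (yes; no)
open import Function using (_∘_; id)
open import Relation.Binary.PropositionalEquality
open ≡-Reasoning

data Compare : ℕ → ℕ → Set where
  less    : ∀ {i j} → i < j → Compare i j
  equal   : ∀ {i} → Compare i i
  greater : ∀ {j} k → Compare (suc (j + k)) j

compare : ∀ i j → Compare i j
compare i j with Nat.compare i j
... | Nat.less _ k    = less (s≤s (m≤m+n i k))
... | Nat.equal _     = equal
... | Nat.greater _ k = greater k

substAt-var-< : ∀ {i j v} → i < j → substAt j v (var i) ≡ var i
substAt-var-< {i} {j} i<j with Nat.compare i j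
... | Nat.less _ _    = refl
... | Nat.equal _     = ⊥-elim (<-irrefl refl i<j)
... | Nat.greater _ k = ⊥-elim (<-asym i<j (s≤s (m≤m+n j k)))

substAt-var-≡ : ∀ {i j v} → i ≡ j → substAt j v (var i) ≡ weaken j v
substAt-var-≡ {i} {j} i≡j with Nat.compare i j
... | Nat.less _ k    = ⊥-elim (m≢1+m+n i i≡j)
... | Nat.equal _     = refl
... | Nat.greater _ k = ⊥-elim (m≢1+m+n j (sym i≡j))

substAt-var-> : ∀ {i j k v} → i ≡ suc (j + k) → substAt j v (var i) ≡ var (j + k)
substAt-var-> {i} {j} {k} i≡1+j+k with Nat.compare i j
... | Nat.less _ k′    =
  ⊥-elim (<-asym (s≤s (m≤m+n i k′)) (subst (j <_) (sym i≡1+j+k) (s≤s (m≤m+n j k))))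
... | Nat.equal _      = ⊥-elim (m≢1+m+n j i≡1+j+k)
... | Nat.greater _ k′ = cong var (suc-injective i≡1+j+k)

shiftFrom-var-< : ∀ {i c} → i < c → shiftFrom c (var i) ≡ var i
shiftFrom-var-< {i} {c} i<c with i <? c
... | yes _  = refl
... | no i≮c = ⊥-elim (i≮c i<c)

shiftFrom-var-≥ : ∀ {i c} → c ≤ i → shiftFrom c (var i) ≡ var (suc i)
shiftFrom-var-≥ {i} {c} c≤i with i <? c
... | yes i<c = ⊥-elim (<⇒≱ i<c c≤i)
... | no _    = refl

shiftFrom-shiftFrom : ∀ {d c} w → d ≤ c →
                      shiftFrom (suc c) (shiftFrom d w) ≡ shiftFrom d (shiftFrom c w)
shiftFrom-shiftFrom {d} {c} (var i) d≤c with <-≤-connex i d | <-≤-connex i c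
... | inj₁ i<d | _
    rewrite shiftFrom-var-< i<d | shiftFrom-var-< (<-≤-trans i<d d≤c)
          | shiftFrom-var-< {c = suc c} (m<n⇒m<1+n (<-≤-trans i<d d≤c)) | shiftFrom-var-< i<d = refl
... | inj₂ d≤i | inj₁ i<c
    rewrite shiftFrom-var-≥ d≤i | shiftFrom-var-< i<c
          | shiftFrom-var-< {c = suc c} (s≤s i<c) | shiftFrom-var-≥ d≤i = refl
... | inj₂ d≤i | inj₂ c≤i
    rewrite shiftFrom-var-≥ d≤i | shiftFrom-var-≥ c≤i
          | shiftFrom-var-≥ {c = suc c} (s≤s c≤i) | shiftFrom-var-≥ (m≤n⇒m≤1+n d≤i) = refl
shiftFrom-shiftFrom top d≤c = refl
shiftFrom-shiftFrom (lam t u) d≤c =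
  cong₂ lam (shiftFrom-shiftFrom t d≤c) (shiftFrom-shiftFrom u (s≤s d≤c))
shiftFrom-shiftFrom (app u v) d≤c = cong₂ app (shiftFrom-shiftFrom u d≤c) (shiftFrom-shiftFrom v d≤c)

substAt-shiftFrom : ∀ j v u → substAt j v (shiftFrom j u) ≡ u
substAt-shiftFrom j v (var i) with <-≤-connex i j
... | inj₁ i<j rewrite shiftFrom-var-< i<j = substAt-var-< i<j
... | inj₂ j≤i with m≤n⇒∃[o]m+o≡n j≤i
...   | k , j+k≡i rewrite shiftFrom-var-≥ j≤i =
  trans (substAt-var-> {j = j} {k} (cong suc (sym j+k≡i))) (cong var j+k≡i)
substAt-shiftFrom j v top = refl
substAt-shiftFrom j v (lam t u) = cong₂ lam (substAt-shiftFrom j v t) (substAt-shiftFrom (suc j) v u)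
substAt-shiftFrom j v (app u w) = cong₂ app (substAt-shiftFrom j v u) (substAt-shiftFrom j v w)

shiftFrom-weaken-≤ : ∀ c n v → c ≤ n → shiftFrom c (weaken n v) ≡ weaken (suc n) v
shiftFrom-weaken-≤ zero    n       v _         = refl
shiftFrom-weaken-≤ (suc c) (suc n) v (s≤s c≤n) =
  trans (shiftFrom-shiftFrom (weaken n v) z≤n) (cong shift (shiftFrom-weaken-≤ c n v c≤n))

shiftFrom-+-weaken : ∀ j c v → shiftFrom (j + c) (weaken j v) ≡ weaken j (shiftFrom c v)
shiftFrom-+-weaken zero    c v = refl
shiftFrom-+-weaken (suc j) c v =
  trans (shiftFrom-shiftFrom (weaken j v) z≤n) (cong shift (shiftFrom-+-weaken j c v))

shiftFrom-substAt-≤ : ∀ c j v u → c ≤ j →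
                      shiftFrom c (substAt j v u) ≡ substAt (suc j) v (shiftFrom c u)
shiftFrom-substAt-≤ c j v (var i) c≤j with compare i j
... | less i<j with <-≤-connex i c
...   | inj₁ i<c rewrite substAt-var-< {v = v} i<j | shiftFrom-var-< i<c =
  sym (substAt-var-< (m<n⇒m<1+n i<j))
...   | inj₂ c≤i rewrite substAt-var-< {v = v} i<j | shiftFrom-var-≥ c≤i =
  sym (substAt-var-< (s≤s i<j))
shiftFrom-substAt-≤ c j v (var j) c≤j | equal
  rewrite substAt-var-≡ {v = v} (refl {x = j}) | shiftFrom-var-≥ c≤j =
  trans (shiftFrom-weaken-≤ c j v c≤j) (sym (substAt-var-≡ {suc j} refl))
shiftFrom-substAt-≤ c j v (var _) c≤j | greater k
  rewrite substAt-var-> {j = j} {k} {v} refl | shiftFrom-var-≥ (≤-trans c≤j (m≤m+n j k))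
        | shiftFrom-var-≥ (≤-trans c≤j (m≤n⇒m≤1+n (m≤m+n j k))) =
  sym (substAt-var-> {j = suc j} {k} refl)
shiftFrom-substAt-≤ c j v top c≤j = refl
shiftFrom-substAt-≤ c j v (lam t u) c≤j =
  cong₂ lam (shiftFrom-substAt-≤ c j v t c≤j) (shiftFrom-substAt-≤ (suc c) (suc j) v u (s≤s c≤j))
shiftFrom-substAt-≤ c j v (app u w) c≤j =
  cong₂ app (shiftFrom-substAt-≤ c j v u c≤j) (shiftFrom-substAt-≤ c j v w c≤j)

shiftFrom-+-substAt : ∀ j c v u →
  shiftFrom (j + c) (substAt j v u) ≡ substAt j (shiftFrom c v) (shiftFrom (suc (j + c)) u)
shiftFrom-+-substAt j c v (var i) with compare i j
... | less i<j
  rewrite substAt-var-< {v = v} i<j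
        | shiftFrom-var-< {c = suc (j + c)} (m<n⇒m<1+n (<-≤-trans i<j (m≤m+n j c)))
        | shiftFrom-var-< (<-≤-trans i<j (m≤m+n j c)) =
  sym (substAt-var-< i<j)
... | equal
  rewrite substAt-var-≡ {j} {j} {v} refl | shiftFrom-var-< {j} {suc (j + c)} (s≤s (m≤m+n j c)) =
  trans (shiftFrom-+-weaken j c v) (sym (substAt-var-≡ {j} refl))
... | greater k with <-≤-connex k c
...   | inj₁ k<c
  rewrite substAt-var-> {j = j} {k} {v} refl
        | shiftFrom-var-< {suc (j + k)} {suc (j + c)} (s≤s (+-monoʳ-< j k<c))
        | shiftFrom-var-< (+-monoʳ-< j k<c) =
  sym (substAt-var-> {j = j} {k} refl)
...   | inj₂ c≤k
  rewrite substAt-var-> {j = j} {k} {v} refl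
        | shiftFrom-var-≥ {suc (j + k)} {suc (j + c)} (s≤s (+-monoʳ-≤ j c≤k))
        | shiftFrom-var-≥ (+-monoʳ-≤ j c≤k) =
  sym (trans (substAt-var-> {j = j} {suc k} (cong suc (sym (+-suc j k)))) (cong var (+-suc j k)))
shiftFrom-+-substAt j c v top = refl
shiftFrom-+-substAt j c v (lam t u) =
  cong₂ lam (shiftFrom-+-substAt j c v t) (shiftFrom-+-substAt (suc j) c v u)
shiftFrom-+-substAt j c v (app u w) = cong₂ app (shiftFrom-+-substAt j c v u) (shiftFrom-+-substAt j c v w)

substAt-+-weaken : ∀ d j v w → substAt (d + j) v (weaken d w) ≡ weaken d (substAt j v w)
substAt-+-weaken zero    j v w = refl
substAt-+-weaken (suc d) j v w =
  trans (sym (shiftFrom-substAt-≤ 0 (d + j) v (weaken d w) z≤n)) (cong shift (substAt-+-weaken d j v w))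

substAt-weaken-≤ : ∀ d e w v → d ≤ e → substAt d w (weaken (suc e) v) ≡ weaken e v
substAt-weaken-≤ d e w v d≤e =
  trans (cong (substAt d w) (sym (shiftFrom-weaken-≤ d e v d≤e))) (substAt-shiftFrom d w (weaken e v))

substAt-substAt : ∀ d j v w u →
  substAt (d + j) v (substAt d w u) ≡ substAt d (substAt j v w) (substAt (suc (d + j)) v u)
substAt-substAt d j v w (var i) with compare i d
... | less i<d
  rewrite substAt-var-< {v = w} i<d
        | substAt-var-< {i} {suc (d + j)} {v} (m<n⇒m<1+n (<-≤-trans i<d (m≤m+n d j)))
        | substAt-var-< {v = v} (<-≤-trans i<d (m≤m+n d j)) =
  sym (substAt-var-< i<d)
... | equal
  rewrite substAt-var-≡ {d} {d} {w} refl | substAt-var-< {d} {suc (d + j)} {v} (s≤s (m≤m+n d j)) =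
  trans (substAt-+-weaken d j v w) (sym (substAt-var-≡ {d} refl))
... | greater k with compare k j
...   | less k<j
  rewrite substAt-var-> {j = d} {k} {w} refl
        | substAt-var-< {suc (d + k)} {suc (d + j)} {v} (s≤s (+-monoʳ-< d k<j))
        | substAt-var-< {v = v} (+-monoʳ-< d k<j) =
  sym (substAt-var-> {j = d} {k} refl)
...   | equal
  rewrite substAt-var-> {j = d} {j} {w} refl
        | substAt-var-≡ {suc (d + j)} {suc (d + j)} {v} refl
        | substAt-var-≡ {d + j} {d + j} {v} refl =
  sym (substAt-weaken-≤ d (d + j) (substAt j v w) v (m≤m+n d j))
...   | greater m = begin
  substAt (d + j) v (substAt d w (var (suc (d + suc (j + m)))))
    ≡⟨ cong (substAt (d + j) v) (substAt-var-> {j = d} {suc (j + m)} refl) ⟩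
  substAt (d + j) v (var (d + suc (j + m)))
    ≡⟨ substAt-var-> {j = d + j} {m} e ⟩
  var (d + j + m)
    ≡⟨ cong var (+-assoc d j m) ⟩
  var (d + (j + m))
    ≡⟨ sym (substAt-var-> {j = d} {j + m} (cong suc (+-assoc d j m))) ⟩
  substAt d (substAt j v w) (var (suc (d + j + m)))
    ≡⟨ cong (substAt d (substAt j v w)) (sym (substAt-var-> {j = suc (d + j)} {m} (cong suc e))) ⟩
  substAt d (substAt j v w) (substAt (suc (d + j)) v (var (suc (d + suc (j + m))))) ∎
  where
  e : d + suc (j + m) ≡ suc (d + j + m)
  e = trans (+-suc d (j + m)) (cong suc (sym (+-assoc d j m)))
substAt-substAt d j v w top = refl
substAt-substAt d j v w (lam t u) = cong₂ lam (substAt-substAt d j v w t) (substAt-substAt (suc d) j v w u)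
substAt-substAt d j v w (app u u′) = cong₂ app (substAt-substAt d j v w u) (substAt-substAt d j v w u′)

→≡-refl : ∀ t → t →≡ t
→≡-refl (var x)   = var
→≡-refl top       = top
→≡-refl (lam t u) = lam (→≡-refl t) (→≡-refl u)
→≡-refl (app u v) = app (→≡-refl u) (→≡-refl v)

→≡-shiftFrom : ∀ c {u u′} → u →≡ u′ → shiftFrom c u →≡ shiftFrom c u′
→≡-shiftFrom c {var x} var = →≡-refl (shiftFrom c (var x))
→≡-shiftFrom c top         = top
→≡-shiftFrom c topApp      = topApp
→≡-shiftFrom c (app e e′)  = app (→≡-shiftFrom c e) (→≡-shiftFrom c e′)
→≡-shiftFrom c (lam e e′)  = lam (→≡-shiftFrom c e) (→≡-shiftFrom (suc c) e′)
→≡-shiftFrom c (beta {u' = u′} {v' = v′} e e′) =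
  subst (_ →≡_) (sym (shiftFrom-+-substAt 0 c v′ u′))
        (beta (→≡-shiftFrom (suc c) e) (→≡-shiftFrom c e′))

→≡-weaken : ∀ n {v v′} → v →≡ v′ → weaken n v →≡ weaken n v′
→≡-weaken zero    e = e
→≡-weaken (suc n) e = →≡-shiftFrom 0 (→≡-weaken n e)

→≡-substAt : ∀ j {u u′ v v′} → u →≡ u′ → v →≡ v′ → substAt j v u →≡ substAt j v′ u′
→≡-substAt j {var i} {v = v} {v′} var ev with compare i j
... | less i<j  = subst₂ _→≡_ (sym (substAt-var-< i<j)) (sym (substAt-var-< i<j)) var
... | equal     =
  subst₂ _→≡_ (sym (substAt-var-≡ {j} refl)) (sym (substAt-var-≡ {j} refl)) (→≡-weaken j ev)
... | greater k =
  subst₂ _→≡_ (sym (substAt-var-> {j = j} {k} refl)) (sym (substAt-var-> {j = j} {k} refl)) var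
→≡-substAt j top        ev = top
→≡-substAt j topApp     ev = topApp
→≡-substAt j (app e e′) ev = app (→≡-substAt j e ev) (→≡-substAt j e′ ev)
→≡-substAt j (lam e e′) ev = lam (→≡-substAt j e ev) (→≡-substAt (suc j) e′ ev)
→≡-substAt j {v′ = v′} (beta {u' = u′} {v' = w′} e e′) ev =
  subst (_ →≡_) (sym (substAt-substAt 0 j v′ w′ u′))
        (beta (→≡-substAt (suc j) e ev) (→≡-substAt j e′ ev))

develop : Term → Term
develop (var x)           = var x
develop top               = top
develop (lam t u)         = lam (develop t) (develop u)
develop (app top v)       = top
develop (app (lam t u) v) = develop u [0:= develop v ]
develop (app u v)         = app (develop u) (develop v)

→≡-develop : ∀ {t t′} → t →≡ t′ → t′ →≡ develop t
→≡-develop var        = var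
→≡-develop top        = top
→≡-develop topApp     = top
→≡-develop (lam e e′) = lam (→≡-develop e) (→≡-develop e′)
→≡-develop (beta e e′) = →≡-substAt 0 (→≡-develop e) (→≡-develop e′)
→≡-develop (app {var x}     var          e′) = app var (→≡-develop e′)
→≡-develop (app {top}       top          e′) = topApp
→≡-develop (app {lam t u}   (lam e₁ e₂)  e′) = beta (→≡-develop e₂) (→≡-develop e′)
→≡-develop (app {app u₁ u₂} e            e′) = app (→≡-develop e) (→≡-develop e′)

Scoped-shiftFrom : ∀ {n u} c → Scoped n u → Scoped (suc n) (shiftFrom c u)
Scoped-shiftFrom {u = var i} c (var i<n) with <-≤-connex i c
... | inj₁ i<c rewrite shiftFrom-var-< i<c = var (m<n⇒m<1+n i<n)
... | inj₂ c≤i rewrite shiftFrom-var-≥ c≤i = var (s≤s i<n)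
Scoped-shiftFrom c top         = top
Scoped-shiftFrom c (lam st su) = lam (Scoped-shiftFrom c st) (Scoped-shiftFrom (suc c) su)
Scoped-shiftFrom c (app su sv) = app (Scoped-shiftFrom c su) (Scoped-shiftFrom c sv)

Scoped-weaken : ∀ {n v} j → Scoped n v → Scoped (j + n) (weaken j v)
Scoped-weaken zero    sv = sv
Scoped-weaken (suc j) sv = Scoped-shiftFrom 0 (Scoped-weaken j sv)

Scoped-substAt : ∀ {n v u} j → Scoped n v → Scoped (suc (j + n)) u → Scoped (j + n) (substAt j v u)
Scoped-substAt {n} {v} {var i} j sv (var i<1+j+n) with compare i j
... | less i<j  = subst (Scoped (j + n)) (sym (substAt-var-< i<j)) (var (<-≤-trans i<j (m≤m+n j n)))
... | equal     = subst (Scoped (j + n)) (sym (substAt-var-≡ {j} refl)) (Scoped-weaken j sv)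
... | greater k = subst (Scoped (j + n)) (sym (substAt-var-> {j = j} {k} refl)) (var (≤-pred i<1+j+n))
Scoped-substAt j sv top         = top
Scoped-substAt j sv (lam st su) = lam (Scoped-substAt j sv st) (Scoped-substAt (suc j) sv su)
Scoped-substAt j sv (app su sw) = app (Scoped-substAt j sv su) (Scoped-substAt j sv sw)

Scoped-→≡ : ∀ {n u u′} → Scoped n u → u →≡ u′ → Scoped n u′
Scoped-→≡ su                  var         = su
Scoped-→≡ su                  top         = su
Scoped-→≡ su                  topApp      = top
Scoped-→≡ (app su sv)         (app e e′)  = app (Scoped-→≡ su e) (Scoped-→≡ sv e′)
Scoped-→≡ (app (lam _ su) sv) (beta e e′) = Scoped-substAt 0 (Scoped-→≡ sv e′) (Scoped-→≡ su e)
Scoped-→≡ (lam st su)         (lam e e′)  = lam (Scoped-→≡ st e) (Scoped-→≡ su e′)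

substCtx : Term → Ctx → Ctx
substCtx α []      = []
substCtx α (t ∷ Γ) = substAt (length Γ) α t ∷ substCtx α Γ

length-substCtx : ∀ α Γ → length (substCtx α Γ) ≡ length Γ
length-substCtx α []      = refl
length-substCtx α (t ∷ Γ) = cong suc (length-substCtx α Γ)

Prevalid-bound-scoped : ∀ Γ₂ α Γ₁ s → Prevalid (Γ₂ ++ α ∷ Γ₁) s → Scoped (length Γ₁) α
Prevalid-bound-scoped Γ₂       α Γ₁ (β ∷ s) (push pv _) = Prevalid-bound-scoped Γ₂ α Γ₁ s pv
Prevalid-bound-scoped []       α Γ₁ []      (ext _ sα)  = sα
Prevalid-bound-scoped (t ∷ Γ₂) α Γ₁ []      (ext pv _)  = Prevalid-bound-scoped Γ₂ α Γ₁ [] pv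

Scoped-substCtx : ∀ Γ₂ α Γ₁ {β} → Scoped (length Γ₁) α → Scoped (length (Γ₂ ++ α ∷ Γ₁)) β →
                  Scoped (length (substCtx α Γ₂ ++ Γ₁)) (substAt (length Γ₂) α β)
Scoped-substCtx Γ₂ α Γ₁ sα sβ =
  subst (λ n → Scoped n _) (sym length-after)
        (Scoped-substAt (length Γ₂) sα (subst (λ n → Scoped n _) length-before sβ))
  where
  length-before : length (Γ₂ ++ α ∷ Γ₁) ≡ suc (length Γ₂ + length Γ₁)
  length-before = trans (length-++ Γ₂) (+-suc (length Γ₂) (length Γ₁))
  length-after : length (substCtx α Γ₂ ++ Γ₁) ≡ length Γ₂ + length Γ₁
  length-after = trans (length-++ (substCtx α Γ₂)) (cong (_+ length Γ₁) (length-substCtx α Γ₂))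

Prevalid-substCtx : ∀ Γ₂ α Γ₁ s → Prevalid (Γ₂ ++ α ∷ Γ₁) s →
                    Prevalid (substCtx α Γ₂ ++ Γ₁) (map (substAt (length Γ₂) α) s)
Prevalid-substCtx Γ₂ α Γ₁ (β ∷ s) (push pv sβ) =
  push (Prevalid-substCtx Γ₂ α Γ₁ s pv)
       (Scoped-substCtx Γ₂ α Γ₁ (Prevalid-bound-scoped Γ₂ α Γ₁ s pv) sβ)
Prevalid-substCtx []       α Γ₁ [] (ext pv _)  = pv
Prevalid-substCtx (t ∷ Γ₂) α Γ₁ [] (ext pv st) =
  ext (Prevalid-substCtx Γ₂ α Γ₁ [] pv)
      (Scoped-substCtx Γ₂ α Γ₁ (Prevalid-bound-scoped Γ₂ α Γ₁ [] pv) st)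

data Lookup-substCtx (α : Term) (Γ₂ Γ₁ : Ctx) : ℕ → Term → Set where
  substituted : Lookup-substCtx α Γ₂ Γ₁ (length Γ₂) (weaken (suc (length Γ₂)) α)
  retained    : ∀ {x t x′ t′} → (substCtx α Γ₂ ++ Γ₁) ∋ x′ ≤ t′ →
                substAt (length Γ₂) α (var x) ≡ var x′ → substAt (length Γ₂) α t ≡ t′ →
                Lookup-substCtx α Γ₂ Γ₁ x t

lookup-substCtx : ∀ Γ₂ α Γ₁ {x t} → (Γ₂ ++ α ∷ Γ₁) ∋ x ≤ t → Lookup-substCtx α Γ₂ Γ₁ x t
lookup-substCtx []       α Γ₁ here = substituted
lookup-substCtx []       α Γ₁ (there {t = t} x≤t) = retained x≤t refl (substAt-shiftFrom 0 α t)
lookup-substCtx (u ∷ Γ₂) α Γ₁ here =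
  retained here refl (sym (shiftFrom-substAt-≤ 0 (length Γ₂) α u z≤n))
lookup-substCtx (u ∷ Γ₂) α Γ₁ (there {i = x} {t = t} x≤t) with lookup-substCtx Γ₂ α Γ₁ x≤t
... | substituted = substituted
... | retained x′≤t′ x↦x′ t↦t′ =
  retained (there x′≤t′)
           (trans (sym (shiftFrom-substAt-≤ 0 (length Γ₂) α (var x) z≤n)) (cong shift x↦x′))
           (trans (sym (shiftFrom-substAt-≤ 0 (length Γ₂) α t z≤n)) (cong shift t↦t′))

map-substAt-shift : ∀ k α s → map (substAt (suc k) α) (map shift s) ≡ map shift (map (substAt k α) s)
map-substAt-shift k α s = begin
  map (substAt (suc k) α) (map shift s)   ≡⟨ map-∘ s ⟨
  map (substAt (suc k) α ∘ shift) s       ≡⟨ map-cong (λ u → sym (shiftFrom-substAt-≤ 0 k α u z≤n)) s ⟩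
  map (shift ∘ substAt k α) s             ≡⟨ map-∘ s ⟩
  map shift (map (substAt k α) s)         ∎

→≤-substAt : ∀ {Γ s u u′} → Γ ⨾ s ⊢ u →≤ u′ → ∀ Γ₂ α Γ₁ → Γ ≡ Γ₂ ++ α ∷ Γ₁ →
  (substCtx α Γ₂ ++ Γ₁) ⨾ map (substAt (length Γ₂) α) s ⊢
    substAt (length Γ₂) α u →≤ substAt (length Γ₂) α u′
→≤-substAt {s = s} (Prom pv x≤t) Γ₂ α Γ₁ refl with lookup-substCtx Γ₂ α Γ₁ x≤t
... | substituted =
  Eq (Prevalid-substCtx Γ₂ α Γ₁ s pv)
     (subst₂ _→≡_ (sym (substAt-var-≡ {length Γ₂} refl))
                  (sym (substAt-weaken-≤ (length Γ₂) (length Γ₂) α α ≤-refl))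
                  (→≡-refl (weaken (length Γ₂) α)))
... | retained x′≤t′ x↦x′ t↦t′ =
  subst₂ (_ ⨾ _ ⊢_→≤_) (sym x↦x′) (sym t↦t′) (Prom (Prevalid-substCtx Γ₂ α Γ₁ s pv) x′≤t′)
→≤-substAt {s = s} (Top pv)  Γ₂ α Γ₁ refl = Top (Prevalid-substCtx Γ₂ α Γ₁ s pv)
→≤-substAt {s = s} (Eq pv e) Γ₂ α Γ₁ refl =
  Eq (Prevalid-substCtx Γ₂ α Γ₁ s pv) (→≡-substAt (length Γ₂) e (→≡-refl α))
→≤-substAt (App d) Γ₂ α Γ₁ refl = App (→≤-substAt d Γ₂ α Γ₁ refl)
→≤-substAt {s = β ∷ s} (FunOp d) Γ₂ α Γ₁ refl =
  FunOp (subst (_ ⨾_⊢ _ →≤ _) (map-substAt-shift (length Γ₂) α s)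
               (→≤-substAt d (β ∷ Γ₂) α Γ₁ refl))
→≤-substAt (Fun {t = t} d) Γ₂ α Γ₁ refl = Fun (→≤-substAt d (t ∷ Γ₂) α Γ₁ refl)

↣-inv-ext : ∀ {t Γ s Γ′ s′} → (t ∷ Γ) ⨾ s ↣ Γ′ ⨾ s′ →
  Σ Term (λ t′ → Σ Ctx (λ Γ″ → (Γ′ ≡ t′ ∷ Γ″) × (t →≡ t′) × (Γ ⨾ s ↣ Γ″ ⨾ s′)))
↣-inv-ext {t} {Γ} refl = t , Γ , refl , →≡-refl t , refl
↣-inv-ext (ext r e)    = _ , _ , refl , e , r
↣-inv-ext (push r e) with ↣-inv-ext r
... | t′ , Γ″ , refl , e′ , r′ = t′ , Γ″ , refl , e′ , push r′ e

↣-inv-push : ∀ {Γ α s Γ′ s′} → Γ ⨾ (α ∷ s) ↣ Γ′ ⨾ s′ →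
  Σ Term (λ α′ → Σ Stack (λ s″ → (s′ ≡ α′ ∷ s″) × (α →≡ α′) × (Γ ⨾ s ↣ Γ′ ⨾ s″)))
↣-inv-push {α = α} {s} refl = α , s , refl , →≡-refl α , refl
↣-inv-push (push r e)       = _ , _ , refl , e , r
↣-inv-push (ext r e) with ↣-inv-push r
... | α′ , s″ , refl , e′ , r′ = α′ , s″ , refl , e′ , ext r′ e

↣-[] : ∀ {Γ Γ′ s′} → Γ ⨾ [] ↣ Γ′ ⨾ s′ → s′ ≡ []
↣-[] refl      = refl
↣-[] (ext r _) = ↣-[] r

↣-length : ∀ {Γ s Γ′ s′} → Γ ⨾ s ↣ Γ′ ⨾ s′ → length Γ ≡ length Γ′
↣-length refl       = refl
↣-length (ext r _)  = cong suc (↣-length r)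
↣-length (push r _) = ↣-length r

↣-map-shift : ∀ {Γ s Γ′ s′} → Γ ⨾ s ↣ Γ′ ⨾ s′ → Γ ⨾ map shift s ↣ Γ′ ⨾ map shift s′
↣-map-shift refl       = refl
↣-map-shift (ext r e)  = ext (↣-map-shift r) e
↣-map-shift (push r e) = push (↣-map-shift r) (→≡-shiftFrom 0 e)

Prevalid-↣ : ∀ {Γ s Γ′ s′} → Prevalid Γ s → Γ ⨾ s ↣ Γ′ ⨾ s′ → Prevalid Γ′ s′
Prevalid-↣ empty refl = empty
Prevalid-↣ (ext pv st) r with ↣-inv-ext r
... | t′ , _ , refl , e , r′ with ↣-[] r′
...   | refl = ext (Prevalid-↣ pv r′) (subst (λ n → Scoped n t′) (↣-length r′) (Scoped-→≡ st e))
Prevalid-↣ (push pv sα) r with ↣-inv-push r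
... | α′ , _ , refl , e , r′ =
  push (Prevalid-↣ pv r′) (subst (λ n → Scoped n α′) (↣-length r′) (Scoped-→≡ sα e))

∋-↣ : ∀ {Γ x t s Γ′ s′} → Γ ∋ x ≤ t → Γ ⨾ s ↣ Γ′ ⨾ s′ → Σ Term (λ t′ → (Γ′ ∋ x ≤ t′) × (t →≡ t′))
∋-↣ here r with ↣-inv-ext r
... | t′ , _ , refl , e , _ = shift t′ , here , →≡-shiftFrom 0 e
∋-↣ (there x≤t) r with ↣-inv-ext r
... | _ , _ , refl , _ , r′ with ∋-↣ x≤t r′
...   | t′ , x≤t′ , e = shift t′ , there x≤t′ , →≡-shiftFrom 0 e

Prevalid-pop : ∀ {Γ α s} → Prevalid Γ (α ∷ s) → Prevalid Γ s
Prevalid-pop (push pv _) = pv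

map-substAt-shift-cancel : ∀ v s → map (substAt 0 v) (map shift s) ≡ s
map-substAt-shift-cancel v s = begin
  map (substAt 0 v) (map shift s)  ≡⟨ map-∘ s ⟨
  map (substAt 0 v ∘ shift) s      ≡⟨ map-cong (substAt-shiftFrom 0 v) s ⟩
  map id s                         ≡⟨ map-id s ⟩
  s                                ∎

CommonReduct : Ctx → Stack → Term → Term → Set
CommonReduct Γ s t₁ t₂ = Σ Term (λ t₃ → (t₂ →≡ t₃) × (Γ ⨾ s ⊢ t₁ →≤ t₃))

commute-Eq : ∀ {Γ s t₀ t₁ t₂} → Prevalid Γ s → t₀ →≡ t₁ → t₀ →≡ t₂ → CommonReduct Γ s t₁ t₂
commute-Eq {t₀ = t₀} pv e₁ e₂ = develop t₀ , →≡-develop e₂ , Eq pv (→≡-develop e₁)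

→≡-→≤-commute : ∀ {Γ s t₀ t₁ t₂} → t₀ →≡ t₁ → Γ ⨾ s ⊢ t₀ →≤ t₂ →
                ∀ {Γ′ s′} → Γ ⨾ s ↣ Γ′ ⨾ s′ → CommonReduct Γ′ s′ t₁ t₂
→≡-→≤-commute e (Top pv)         r = top , top , Top (Prevalid-↣ pv r)
→≡-→≤-commute e (Eq pv e′)       r = commute-Eq (Prevalid-↣ pv r) e e′
→≡-→≤-commute e (App (Top pv))   r = top , topApp , Top (Prevalid-↣ (Prevalid-pop pv) r)
→≡-→≤-commute e (App (Eq pv e′)) r =
  commute-Eq (Prevalid-↣ (Prevalid-pop pv) r) e (app e′ (→≡-refl _))
→≡-→≤-commute var (Prom pv x≤t) r with ∋-↣ x≤t r
... | t′ , x≤t′ , e = t′ , e , Prom (Prevalid-↣ pv r) x≤t′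
→≡-→≤-commute (app e₁ e₂) (App d) r with →≡-→≤-commute e₁ d (push r e₂)
... | u₃ , f , g = app u₃ _ , app f e₂ , App g
→≡-→≤-commute (beta {v' = v′} e₁ e₂) (App (FunOp d)) {Γ′} {s′} r
  with →≡-→≤-commute e₁ d (ext (↣-map-shift r) e₂)
... | u₃ , f , g =
  u₃ [0:= v′ ] , beta f e₂ ,
  subst (Γ′ ⨾_⊢ _ →≤ _) (map-substAt-shift-cancel v′ s′) (→≤-substAt g [] v′ Γ′ refl)
→≡-→≤-commute (lam e₁ e₂) (FunOp d) r with ↣-inv-push r
... | _ , _ , refl , eα , r′ with →≡-→≤-commute e₂ d (ext (↣-map-shift r′) eα)
...   | u₃ , f , g = lam _ u₃ , lam e₁ f , FunOp g
→≡-→≤-commute (lam e₁ e₂) (Fun d) r with ↣-[] r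
... | refl with →≡-→≤-commute e₂ d (ext r e₁)
...   | u₃ , f , g = lam _ u₃ , lam e₁ f , Fun g

theorem4p5 : (Γ : Ctx) (s : Stack) (t₀ t₁ t₂ : Term) →
    t₀ →≡ t₁ → Γ ⨾ s ⊢ t₀ →≤ t₂ →
    (Γ' : Ctx) (s' : Stack) → Γ ⨾ s ↣ Γ' ⨾ s' →
    Σ Term (λ t₃ → (t₂ →≡ t₃) × (Γ' ⨾ s' ⊢ t₁ →≤ t₃))
theorem4p5 _ _ _ _ _ e d _ _ r = →≡-→≤-commute e d r
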